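{- Let $(E,\mathcal F)$ be an upper interval greedoid (antimatroid). If $(E,\mathcal F,\mathcal L)$ is an oriented interval greedoid, then $\mathcal L$ is the set of all covectors of $(E,\mathcal F)$.
   Context: An upper interval greedoid (antimatroid) is a finite set $E$ and a nonempty family $\mathcal F$ of subsets satisfying: (IG1) every nonempty $X\in\mathcal F$ has $x\in X$ with $X\setminus\{x\}\in\mathcal F$; (IG2) if $X,Y\in\mathcal F$, $|X|>|Y|$, there is $x\in X\setminus Y$ with $Y\cup\{x\}\in\mathcal F$; (UIP) if $X\subseteq Y$ in $\mathcal F$, $e\in E\setminus Y$ and $X\cup\{e\}\in\mathcal F$, then $Y\cup\{e\}\in\mathcal F$. Such a pair is an interval greedoid (also satisfies (IG3): if $X\subseteq Y\subseteq Z$ in $\mathcal F$, $e\notin Z$, $X\cup\{e\},Z\cup\{e\}\in\mathcal F$, then $Y\cup\{e\}\in\mathcal F$). For an interval greedoid: $\Gamma(X)=\{x\in E\setminus X:X\cup\{x\}\in\mathcal F\}$; $X\sim Y$ iff $\Gamma(X)=\Gamma(Y)$; classes $[X]$ are flats; $\Phi$ the set of flats ordered by $[X]\le[Y]$ iff there is $Z\subseteq E\setminus Y$ with $Y\cup Z\in\mathcal F$ and $Y\cup Z\sim X$ (a lattice). For a flat $A=[X]$: $\Gamma(A)=\Gamma(X)$, $\xi(A)=\bigcup_{X'\sim X}X'$. $\mu(S)=[X]$ for $X$ inclusion-maximal feasible in $S$; join $A\vee B=\mu(\xi(A)\cap\xi(B))$. A covector is $\alpha:E\to\{0,+,-,1\}$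 such that for some flat $A=\mathrm{supp}(\alpha)$, $\alpha\in\{+,-\}$ on $\Gamma(A)$, $0$ on $\xi(A)$, $1$ elsewhere. Symbols ordered $0<+<1$, $0<-<1$. Product: with $C=\mathrm{supp}\,\alpha\vee\mathrm{supp}\,\beta$, $(\alpha\circ\beta)(e)=\beta(e)$ if $e\in\Gamma(C)\cup\xi(C)$ and $\beta(e)>\alpha(e)$; $\alpha(e)$ if $e\in\Gamma(C)\cup\xi(C)$ otherwise; $1$ otherwise. $-\alpha$ swaps $+,-$; $S(\alpha,\beta)=\{e:\alpha(e)=-\beta(e)\in\{+,-\}\}$. Oriented interval greedoid: $(E,\mathcal F,\mathcal L)$, $\mathcal L$ a set of covectors with (OG1) $\mathrm{supp}:\mathcal L\to\Phi$ surjective; (OG2) $-\mathcal L=\mathcal L$; (OG3) closed under $\circ$; (OG4) if $\alpha,\beta\in\mathcal L$, $x\in S(\alpha,\beta)$, $(\alpha\circ\beta)(x)\ne1$, some $\gamma\in\mathcal L$ has $\gamma(x)=0$ and $\gamma(y)=(\alpha\circ\beta)(y)=(\beta\circ\alpha)(y)$ for all $y\notin S(\alpha,\beta)$ with $(\alpha\circ\beta)(y)\neq1$. -}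

module Defs where

open import Data.Nat using (ℕ; _>_)
open import Data.Bool using (Bool; true; false)
open import Data.Fin using (Fin)
open import Data.Fin.Subset
  using (Subset; _∈_; _∉_; _⊆_; _⊂_; _∩_; _∪_; _-_; ⁅_⁆; ∣_∣; Nonempty)
open import Data.Vec using (Vec; lookup; tabulate; map)
open import Data.Product using (Σ; ∃; ∃-syntax; _×_; _,_)
open import Data.Sum using (_⊎_)
open import Relation.Nullary using (¬_)
open import Relation.Binary.PropositionalEquality using (_≡_; _≢_)
open import Function.Bundles using (_⇔_)

Family : ℕ → Set
Family n = Subset n → Bool

module _ {n : ℕ} (F : Family n) where

  Feasible : Subset n → Set
  Feasible X = F X ≡ true

  InΓ : Subset n → Fin n → Set
  InΓ X x = x ∉ X × Feasible (X ∪ ⁅ x ⁆)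

  _∼_ : Subset n → Subset n → Set
  X ∼ Y = ∀ e → InΓ X e ⇔ InΓ Y e

  Inξ : Subset n → Fin n → Set
  Inξ X e = ∃[ X' ] (Feasible X' × X' ∼ X × e ∈ X')

record IsAntimatroid {n : ℕ} (F : Family n) : Set where
  field
    nonempty : ∃[ X ] Feasible F X
    IG1 : ∀ X → Feasible F X → Nonempty X →
          ∃[ x ] (x ∈ X × Feasible F (X - x))
    IG2 : ∀ X Y → Feasible F X → Feasible F Y → ∣ X ∣ > ∣ Y ∣ →
          ∃[ x ] (x ∈ X × x ∉ Y × Feasible F (Y ∪ ⁅ x ⁆))
    UIP : ∀ X Y e → Feasible F X → Feasible F Y → X ⊆ Y → e ∉ Y →
          Feasible F (X ∪ ⁅ e ⁆) → Feasible F (Y ∪ ⁅ e ⁆)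

data Sym : Set where
  𝟘 ⊕ ⊖ 𝟙 : Sym

data _<ₛ_ : Sym → Sym → Set where
  0<+ : 𝟘 <ₛ ⊕
  0<- : 𝟘 <ₛ ⊖
  0<1 : 𝟘 <ₛ 𝟙
  +<1 : ⊕ <ₛ 𝟙
  -<1 : ⊖ <ₛ 𝟙

IsSign : Sym → Set
IsSign s = s ≡ ⊕ ⊎ s ≡ ⊖

negS : Sym → Sym
negS ⊕ = ⊖
negS ⊖ = ⊕
negS 𝟘 = 𝟘
negS 𝟙 = 𝟙

-- prodS a b = b if b > a, and a otherwise
prodS : Sym → Sym → Sym
prodS 𝟘 ⊕ = ⊕
prodS 𝟘 ⊖ = ⊖
prodS 𝟘 𝟙 = 𝟙
prodS ⊕ 𝟙 = 𝟙
prodS ⊖ 𝟙 = 𝟙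
prodS a b = a

Covec : ℕ → Set
Covec n = Vec Sym n

neg : ∀ {n} → Covec n → Covec n
neg = map negS

module _ {n : ℕ} (F : Family n) where

  -- supp α = [X]: X feasible, α ∈ {+,-} on Γ(X), 0 on ξ([X]), 1 elsewhere.
  -- (This depends only on the flat [X].)
  IsSuppRep : Covec n → Subset n → Set
  IsSuppRep α X =
    Feasible F X ×
    (∀ e → InΓ F X e → IsSign (lookup α e)) ×
    (∀ e → Inξ F X e → lookup α e ≡ 𝟘) ×
    (∀ e → ¬ InΓ F X e → ¬ Inξ F X e → lookup α e ≡ 𝟙)

  IsCovector : Covec n → Set
  IsCovector α = ∃[ X ] IsSuppRep α X

  MaxFeasibleIn : (Fin n → Set) → Subset n → Set
  MaxFeasibleIn S Z =
    Feasible F Z × (∀ e → e ∈ Z → S e) ×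
    (∀ W → Feasible F W → Z ⊂ W → ¬ (∀ e → e ∈ W → S e))

  -- [Z] = [X] ∨ [Y] = μ(ξ([X]) ∩ ξ([Y]))
  IsJoinRep : Subset n → Subset n → Subset n → Set
  IsJoinRep X Y Z = MaxFeasibleIn (λ e → Inξ F X e × Inξ F Y e) Z

  IsProdWith : Subset n → Covec n → Covec n → Covec n → Set
  IsProdWith Z α β γ = ∀ e →
    ((InΓ F Z e ⊎ Inξ F Z e) → lookup γ e ≡ prodS (lookup α e) (lookup β e)) ×
    (¬ InΓ F Z e → ¬ Inξ F Z e → lookup γ e ≡ 𝟙)

InSep : ∀ {n} → Covec n → Covec n → Fin n → Set
InSep α β e = IsSign (lookup α e) × lookup α e ≡ negS (lookup β e)

record IsOrientedIG {n : ℕ} (F : Family n) (L : Covec n → Bool) : Set where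
  InL : Covec n → Set
  InL α = L α ≡ true
  field
    covectors : ∀ α → InL α → IsCovector F α
    OG1 : ∀ X → Feasible F X → ∃[ α ] (InL α × IsSuppRep F α X)
    OG2 : ∀ α → InL α → InL (neg α)
    OG3 : ∀ α β X Y Z γ → InL α → InL β →
          IsSuppRep F α X → IsSuppRep F β Y → IsJoinRep F X Y Z →
          IsProdWith F Z α β γ → InL γ
    OG4 : ∀ α β X Y Z γ δ x → InL α → InL β →
          IsSuppRep F α X → IsSuppRep F β Y → IsJoinRep F X Y Z →
          IsProdWith F Z α β γ → IsProdWith F Z β α δ →
          InSep α β x → lookup γ x ≢ 𝟙 →
          ∃[ ε ] (InL ε × lookup ε x ≡ 𝟘 ×
            (∀ y → ¬ InSep α β y → lookup γ y ≢ 𝟙 →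
               lookup ε y ≡ lookup γ y × lookup ε y ≡ lookup δ y))

-- In an antimatroid every flat [X] of a feasible X satisfies ξ([X]) = X: a feasible X' with
-- Γ(X') = Γ(X) is built up by single extensions, and by the upper interval property none of
-- them can leave X.  Hence a covector with support [X] is just a choice of signs on Γ(X).
-- Such a covector lies in L by downward induction on X.  If Γ(X) = ∅ it is the unique
-- covector with support [X], which L contains by (OG1).  Otherwise pick e ∈ Γ(X): the
-- covector β with support [X ∪ e] carrying the signs of α lies in L by induction, and
-- α = β ∘ α' for the representative α' ∈ L of [X] (given by (OG1), negated by (OG2) if
-- need be) that agrees with α at e; so α ∈ L by (OG3).
module Submission where

open import Defs
open import Data.Nat using (ℕ; _<_)
open import Data.Nat.Induction using (<-wellFounded)
open import Data.Bool using (Bool; true)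
import Data.Bool as Bool
open import Data.Fin using (Fin)
open import Data.Fin.Properties using (any?) renaming (_≟_ to _≟ᶠ_)
open import Data.Fin.Subset using (Subset; _∈_; _∉_; _⊆_; _∪_; _-_; ⁅_⁆; ∣_∣; ∁)
open import Data.Fin.Subset.Properties
  using (_∈?_; ⊆-antisym; x∈p∪q⁻; x∈p∪q⁺; p⊆p∪q; p─q⊆p; x∈⁅x⁆; x∈⁅y⁆⇒x≡y;
         x∈p∧x≢y⇒x∈p-y; x∈p⇒∣p-x∣<∣p∣; p⊂q⇒∣p∣<∣q∣; p⊆q⇒∁p⊇∁q; x∉p⇒x∈∁p; x∈p⇒x∉∁p)
open import Data.Vec using (lookup; tabulate)
open import Data.Vec.Properties using (lookup∘tabulate; lookup-map)
open import Data.Vec.Relation.Binary.Pointwise.Extensional using (ext; Pointwise-≡⇒≡)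
open import Data.Product using (∃-syntax; _×_; _,_; proj₁; proj₂)
open import Data.Sum using (_⊎_; inj₁; inj₂)
open import Induction.WellFounded using (Acc; acc)
open import Relation.Nullary using (Dec; yes; no; ¬_; contradiction)
open import Relation.Nullary.Decidable using (_×-dec_; ¬?; decidable-stable)
open import Relation.Binary.PropositionalEquality
open import Function.Bundles using (_⇔_; mk⇔; Equivalence)

-- Forces a symbol into {+,-}; the values at 𝟘 and 𝟙 are arbitrary.
signOf : Sym → Sym
signOf ⊖ = ⊖
signOf _ = ⊕

signOf-IsSign : ∀ s → IsSign (signOf s)
signOf-IsSign 𝟘 = inj₁ refl
signOf-IsSign ⊕ = inj₁ refl
signOf-IsSign ⊖ = inj₂ refl
signOf-IsSign 𝟙 = inj₁ refl

signOf-sign : ∀ {s} → IsSign s → signOf s ≡ s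
signOf-sign (inj₁ refl) = refl
signOf-sign (inj₂ refl) = refl

negS-IsSign : ∀ {s} → IsSign s → IsSign (negS s)
negS-IsSign (inj₁ refl) = inj₂ refl
negS-IsSign (inj₂ refl) = inj₁ refl

sign≡⊎negS-sign≡ : ∀ {s t} → IsSign s → IsSign t → s ≡ t ⊎ negS s ≡ t
sign≡⊎negS-sign≡ (inj₁ refl) (inj₁ refl) = inj₁ refl
sign≡⊎negS-sign≡ (inj₁ refl) (inj₂ refl) = inj₂ refl
sign≡⊎negS-sign≡ (inj₂ refl) (inj₁ refl) = inj₂ refl
sign≡⊎negS-sign≡ (inj₂ refl) (inj₂ refl) = inj₁ refl

prodS-identityˡ : ∀ s → prodS 𝟘 s ≡ s
prodS-identityˡ 𝟘 = refl
prodS-identityˡ ⊕ = refl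
prodS-identityˡ ⊖ = refl
prodS-identityˡ 𝟙 = refl

prodS-sign : ∀ {s t} → IsSign s → IsSign t → prodS s t ≡ s
prodS-sign (inj₁ refl) (inj₁ refl) = refl
prodS-sign (inj₁ refl) (inj₂ refl) = refl
prodS-sign (inj₂ refl) (inj₁ refl) = refl
prodS-sign (inj₂ refl) (inj₂ refl) = refl

p-x∪⁅x⁆≡p : ∀ {n} {p : Subset n} {x} → x ∈ p → (p - x) ∪ ⁅ x ⁆ ≡ p
p-x∪⁅x⁆≡p {p = p} {x} x∈p = ⊆-antisym ⊆p p⊆
  where
  ⊆p : (p - x) ∪ ⁅ x ⁆ ⊆ p
  ⊆p z∈ with x∈p∪q⁻ (p - x) ⁅ x ⁆ z∈
  ... | inj₁ z∈p-x = p─q⊆p p ⁅ x ⁆ z∈p-x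
  ... | inj₂ z∈⁅x⁆ = subst (_∈ p) (sym (x∈⁅y⁆⇒x≡y x z∈⁅x⁆)) x∈p
  p⊆ : p ⊆ (p - x) ∪ ⁅ x ⁆
  p⊆ {z} z∈p with z ≟ᶠ x
  ... | yes refl = x∈p∪q⁺ (inj₂ (x∈⁅x⁆ z))
  ... | no z≢x = x∈p∪q⁺ (inj₁ (x∈p∧x≢y⇒x∈p-y z∈p z≢x))

∣∁p∪⁅x⁆∣<∣∁p∣ : ∀ {n} {p : Subset n} {x} → x ∉ p → ∣ ∁ (p ∪ ⁅ x ⁆) ∣ < ∣ ∁ p ∣
∣∁p∪⁅x⁆∣<∣∁p∣ {x = x} x∉p = p⊂q⇒∣p∣<∣q∣
  ( p⊆q⇒∁p⊇∁q (p⊆p∪q ⁅ x ⁆) , x , x∉p⇒x∈∁p x∉p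
  , x∈p⇒x∉∁p (x∈p∪q⁺ (inj₂ (x∈⁅x⁆ x))))

module _ {n : ℕ} (F : Family n) where

  InΓ? : ∀ X e → Dec (InΓ F X e)
  InΓ? X e = ¬? (e ∈? X) ×-dec (F (X ∪ ⁅ e ⁆) Bool.≟ true)

  ∈⇒Inξ : ∀ {X e} → Feasible F X → e ∈ X → Inξ F X e
  ∈⇒Inξ {X} fX e∈X = X , fX , (λ _ → mk⇔ (λ h → h) (λ h → h)) , e∈X

  IsSuppRep-neg : ∀ {α X} → IsSuppRep F α X → IsSuppRep F (neg α) X
  IsSuppRep-neg {α} (fX , α-sign , α-zero , α-one) =
    fX ,
    (λ e e∈Γ → subst IsSign (sym (lookup-map e negS α)) (negS-IsSign (α-sign e e∈Γ))) ,
    (λ e e∈ξ → trans (lookup-map e negS α) (cong negS (α-zero e e∈ξ))) ,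
    (λ e e∉Γ e∉ξ → trans (lookup-map e negS α) (cong negS (α-one e e∉Γ e∉ξ)))

  covectorOn-entry : Subset n → (Fin n → Sym) → Fin n → Sym
  covectorOn-entry Y σ e with e ∈? Y | InΓ? Y e
  ... | yes _ | _     = 𝟘
  ... | no _  | yes _ = signOf (σ e)
  ... | no _  | no _  = 𝟙

  -- In an antimatroid ξ(Y) = Y, so this is the covector with support [Y] and the signs of σ.
  covectorOn : Subset n → (Fin n → Sym) → Covec n
  covectorOn Y σ = tabulate (covectorOn-entry Y σ)

  module _ {Y : Subset n} {σ : Fin n → Sym} where

    covectorOn-∈ : ∀ {e} → e ∈ Y → lookup (covectorOn Y σ) e ≡ 𝟘
    covectorOn-∈ {e} e∈Y rewrite lookup∘tabulate (covectorOn-entry Y σ) e with e ∈? Y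
    ... | yes _   = refl
    ... | no e∉Y = contradiction e∈Y e∉Y

    covectorOn-Γ : ∀ {e} → InΓ F Y e → lookup (covectorOn Y σ) e ≡ signOf (σ e)
    covectorOn-Γ {e} e∈Γ rewrite lookup∘tabulate (covectorOn-entry Y σ) e
      with e ∈? Y | InΓ? Y e
    ... | yes e∈Y | _      = contradiction e∈Y (proj₁ e∈Γ)
    ... | no _    | yes _  = refl
    ... | no _    | no e∉Γ = contradiction e∈Γ e∉Γ

    covectorOn-∉ : ∀ {e} → e ∉ Y → ¬ InΓ F Y e → lookup (covectorOn Y σ) e ≡ 𝟙
    covectorOn-∉ {e} e∉Y e∉Γ rewrite lookup∘tabulate (covectorOn-entry Y σ) e
      with e ∈? Y | InΓ? Y e
    ... | yes e∈Y | _       = contradiction e∈Y e∉Y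
    ... | no _    | yes e∈Γ = contradiction e∈Γ e∉Γ
    ... | no _    | no _    = refl

module _ {n : ℕ} {F : Family n} (AM : IsAntimatroid F) where
  open IsAntimatroid AM

  ∼⇒⊆ : ∀ {X' X} → Feasible F X' → Feasible F X → _∼_ F X' X → X' ⊆ X
  ∼⇒⊆ {X'} {X} fX' fX X'∼X = go X' (<-wellFounded ∣ X' ∣) fX' (λ h → h)
    where
    go : ∀ Y → Acc _<_ ∣ Y ∣ → Feasible F Y → Y ⊆ X' → Y ⊆ X
    go Y (acc rs) fY Y⊆X' {z} z∈Y with IG1 Y fY (z , z∈Y)
    ... | x , x∈Y , fY-x = z∈X
      where
      Y-x⊆X : Y - x ⊆ X
      Y-x⊆X = go (Y - x) (rs (x∈p⇒∣p-x∣<∣p∣ x∈Y)) fY-x (λ h → Y⊆X' (p─q⊆p Y ⁅ x ⁆ h))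
      -- Otherwise UIP puts x into Γ(X) = Γ(X'), although x ∈ Y ⊆ X'.
      x∈X : x ∈ X
      x∈X = decidable-stable (x ∈? X) λ x∉X →
        let fX∪x = UIP (Y - x) X x fY-x fX Y-x⊆X x∉X
                     (subst (Feasible F) (sym (p-x∪⁅x⁆≡p x∈Y)) fY)
        in proj₁ (Equivalence.from (X'∼X x) (x∉X , fX∪x)) (Y⊆X' x∈Y)
      z∈X : z ∈ X
      z∈X with z ≟ᶠ x
      ... | yes refl = x∈X
      ... | no z≢x  = Y-x⊆X (x∈p∧x≢y⇒x∈p-y z∈Y z≢x)

  Inξ⇒∈ : ∀ {X e} → Feasible F X → Inξ F X e → e ∈ X
  Inξ⇒∈ fX (X' , fX' , X'∼X , e∈X') = ∼⇒⊆ fX' fX X'∼X e∈X'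

  IsSuppRep-unique : ∀ {α β X} → IsSuppRep F α X → IsSuppRep F β X →
                     (∀ e → InΓ F X e → lookup α e ≡ lookup β e) → α ≡ β
  IsSuppRep-unique {α} {β} {X} (fX , _ , α-zero , α-one) (_ , _ , β-zero , β-one) agree =
    Pointwise-≡⇒≡ (ext entry)
    where
    entry : ∀ e → lookup α e ≡ lookup β e
    entry e with InΓ? F X e | e ∈? X
    ... | yes e∈Γ | _       = agree e e∈Γ
    ... | no _    | yes e∈X =
      trans (α-zero e (∈⇒Inξ F fX e∈X)) (sym (β-zero e (∈⇒Inξ F fX e∈X)))
    ... | no e∉Γ  | no e∉X  =
      trans (α-one e e∉Γ e∉ξ) (sym (β-one e e∉Γ e∉ξ))
      where
      e∉ξ : ¬ Inξ F X e
      e∉ξ e∈ξ = e∉X (Inξ⇒∈ fX e∈ξ)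

  covectorOn-IsSuppRep : ∀ {Y σ} → Feasible F Y → IsSuppRep F (covectorOn F Y σ) Y
  covectorOn-IsSuppRep {Y} {σ} fY =
    fY ,
    (λ e e∈Γ → subst IsSign (sym (covectorOn-Γ F e∈Γ)) (signOf-IsSign (σ e))) ,
    (λ e e∈ξ → covectorOn-∈ F (Inξ⇒∈ fY e∈ξ)) ,
    (λ e e∉Γ e∉ξ → covectorOn-∉ F (λ e∈Y → e∉ξ (∈⇒Inξ F fY e∈Y)) e∉Γ)

  ⊆⇒IsJoinRep : ∀ {X Y} → Feasible F X → Feasible F Y → X ⊆ Y → IsJoinRep F Y X X
  ⊆⇒IsJoinRep fX fY X⊆Y =
    fX ,
    (λ e e∈X → ∈⇒Inξ F fY (X⊆Y e∈X) , ∈⇒Inξ F fX e∈X) ,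
    (λ { W _ (_ , w , w∈W , w∉X) ⊆ξ → w∉X (Inξ⇒∈ fX (proj₂ (⊆ξ w w∈W))) })

  InΓ-∪⁅⁆ : ∀ {X e i} → Feasible F X → InΓ F X e → InΓ F X i → i ≢ e →
            InΓ F (X ∪ ⁅ e ⁆) i
  InΓ-∪⁅⁆ {X} {e} {i} fX (_ , fX∪e) (i∉X , fX∪i) i≢e =
    i∉X∪e , UIP X (X ∪ ⁅ e ⁆) i fX fX∪e (p⊆p∪q ⁅ e ⁆) i∉X∪e fX∪i
    where
    i∉X∪e : i ∉ X ∪ ⁅ e ⁆
    i∉X∪e i∈ with x∈p∪q⁻ X ⁅ e ⁆ i∈
    ... | inj₁ i∈X = i∉X i∈X
    ... | inj₂ i∈⁅e⁆ = i≢e (x∈⁅y⁆⇒x≡y e i∈⁅e⁆)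

  IsProdWith-covectorOn : ∀ {α α' X e} → IsSuppRep F α X → IsSuppRep F α' X →
    InΓ F X e → lookup α' e ≡ lookup α e →
    IsProdWith F X (covectorOn F (X ∪ ⁅ e ⁆) (lookup α)) α' α
  IsProdWith-covectorOn {α} {α'} {X} {e} (fX , α-sign , α-zero , α-one)
                        (_ , α'-sign , α'-zero , _) e∈Γ α'e≡αe i =
    product , α-one i
    where
    open ≡-Reasoning
    β : Covec n
    β = covectorOn F (X ∪ ⁅ e ⁆) (lookup α)

    product : InΓ F X i ⊎ Inξ F X i → lookup α i ≡ prodS (lookup β i) (lookup α' i)
    product (inj₂ i∈ξ) = begin
      lookup α i                       ≡⟨ α-zero i i∈ξ ⟩
      𝟘                                ≡⟨ sym (α'-zero i i∈ξ) ⟩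
      lookup α' i                      ≡⟨ prodS-identityˡ _ ⟨
      prodS 𝟘 (lookup α' i)            ≡⟨ cong (λ s → prodS s _) β≡𝟘 ⟨
      prodS (lookup β i) (lookup α' i) ∎
      where
      β≡𝟘 : lookup β i ≡ 𝟘
      β≡𝟘 = covectorOn-∈ F (p⊆p∪q ⁅ e ⁆ (Inξ⇒∈ fX i∈ξ))
    product (inj₁ i∈Γ) with i ≟ᶠ e
    ... | yes refl = begin
      lookup α i                       ≡⟨ α'e≡αe ⟨
      lookup α' i                      ≡⟨ prodS-identityˡ _ ⟨
      prodS 𝟘 (lookup α' i)            ≡⟨ cong (λ s → prodS s _) β≡𝟘 ⟨
      prodS (lookup β i) (lookup α' i) ∎
      where
      β≡𝟘 : lookup β i ≡ 𝟘
      β≡𝟘 = covectorOn-∈ F (x∈p∪q⁺ (inj₂ (x∈⁅x⁆ i)))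
    ... | no i≢e = begin
      lookup α i                       ≡⟨ prodS-sign (α-sign i i∈Γ) (α'-sign i i∈Γ) ⟨
      prodS (lookup α i) (lookup α' i) ≡⟨ cong (λ s → prodS s _) β≡α ⟨
      prodS (lookup β i) (lookup α' i) ∎
      where
      β≡α : lookup β i ≡ lookup α i
      β≡α = trans (covectorOn-Γ F (InΓ-∪⁅⁆ fX e∈Γ i∈Γ i≢e)) (signOf-sign (α-sign i i∈Γ))

module _ {n : ℕ} {F : Family n} {L : Covec n → Bool}
         (AM : IsAntimatroid F) (OIG : IsOrientedIG F L) where
  open IsOrientedIG OIG

  signedRepresentative : ∀ {X e s} → Feasible F X → InΓ F X e → IsSign s →
                         ∃[ α ] (InL α × IsSuppRep F α X × lookup α e ≡ s)
  signedRepresentative {X} {e} fX e∈Γ s-sign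
    with OG1 X fX
  ... | α₀ , α₀∈L , rep₀@(_ , sign₀ , _) with sign≡⊎negS-sign≡ (sign₀ e e∈Γ) s-sign
  ...   | inj₁ α₀e≡s = α₀ , α₀∈L , rep₀ , α₀e≡s
  ...   | inj₂ -α₀e≡s = neg α₀ , OG2 α₀ α₀∈L , IsSuppRep-neg F {α₀} rep₀ ,
                        trans (lookup-map e negS α₀) -α₀e≡s

  covector∈L : ∀ {α X} → IsSuppRep F α X → InL α
  covector∈L {α} {X} = go X (<-wellFounded ∣ ∁ X ∣) α
    where
    go : ∀ X → Acc _<_ ∣ ∁ X ∣ → ∀ α → IsSuppRep F α X → InL α
    go X (acc rs) α rep@(fX , α-sign , _) with any? (InΓ? F X) | OG1 X fX
    ... | no Γ≡∅ | α₀ , α₀∈L , rep₀ =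
      subst InL (IsSuppRep-unique AM rep₀ rep (λ e e∈Γ → contradiction (e , e∈Γ) Γ≡∅)) α₀∈L
    ... | yes (e , e∈Γ@(e∉X , fX∪e)) | _ =
      let α' , α'∈L , rep' , α'e≡αe = signedRepresentative fX e∈Γ (α-sign e e∈Γ)
          β = covectorOn F (X ∪ ⁅ e ⁆) (lookup α)
          repβ = covectorOn-IsSuppRep AM fX∪e
          β∈L = go (X ∪ ⁅ e ⁆) (rs (∣∁p∪⁅x⁆∣<∣∁p∣ e∉X)) β repβ
      in OG3 β α' (X ∪ ⁅ e ⁆) X X α β∈L α'∈L repβ rep'
             (⊆⇒IsJoinRep AM fX fX∪e (p⊆p∪q ⁅ e ⁆))
             (IsProdWith-covectorOn AM {α} {α'} rep rep' e∈Γ α'e≡αe)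

mainTheorem7 : (n : ℕ) (F : Family n) (L : Covec n → Bool) →
    IsAntimatroid F → IsOrientedIG F L →
    ∀ α → (L α ≡ true ⇔ IsCovector F α)
mainTheorem7 n F L AM OIG α =
  mk⇔ (IsOrientedIG.covectors OIG α) (λ (X , rep) → covector∈L AM OIG rep)
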